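{- Let $k\geq 4$ be an integer. Every finite $k$-chordal bipartite graph is trivial, i.e. contains no cycle of length at least $6$.
   Context: Graphs are finite and simple. A chord of a cycle $C$ is an edge of the graph joining two vertices of $C$ that is not an edge of $C$. For an integer $k\geq1$, a bipartite graph is $k$-chordal bipartite if every cycle of length at least $6$ has at least $k$ chords. A $k$-chordal bipartite graph is called trivial if it contains no cycle of length $6$ or greater. -}

module Defs where

open import Data.Nat using (ℕ; suc; _<_; _≤_)
open import Data.Fin using (Fin; toℕ)
open import Data.Bool using (Bool)
open import Data.Product using (Σ; ∃; _×_; proj₁; _,_)
open import Data.Sum using (_⊎_)
open import Relation.Nullary using (¬_)
open import Relation.Binary.PropositionalEquality using (_≡_; _≢_)
open import Function.Definitions using (Injective)

record Graph (n : ℕ) : Set₁ where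
  field
    Adj   : Fin n → Fin n → Set
    sym   : ∀ {u v} → Adj u v → Adj v u
    irrefl : ∀ {u} → ¬ Adj u u
open Graph public

IsBipartite : ∀ {n} → Graph n → Set
IsBipartite {n} G = Σ (Fin n → Bool) λ c → ∀ {u v} → Adj G u v → c u ≢ c v

CycNext : (m : ℕ) → Fin m → Fin m → Set
CycNext m i j = (suc (toℕ i) ≡ toℕ j) ⊎ ((suc (toℕ i) ≡ m) × (toℕ j ≡ 0))

record Cycle {n : ℕ} (G : Graph n) (m : ℕ) : Set where
  field
    vtx      : Fin m → Fin n
    vtx-inj  : Injective _≡_ _≡_ vtx
    len≥3    : 3 ≤ m
    edges    : ∀ i j → CycNext m i j → Adj G (vtx i) (vtx j)
open Cycle public

-- A chord of a cycle C, given as an unordered pair of positions {i, j} (i < j)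
-- which are not cyclically consecutive, whose vertices are adjacent in G.
-- (By injectivity of vtx, this is exactly an edge of G joining two vertices
-- of C that is not an edge of C.)
IsChord : ∀ {n m} {G : Graph n} → Cycle G m → Fin m × Fin m → Set
IsChord {m = m} {G} C (i , j) =
  (toℕ i < toℕ j) × ¬ CycNext m i j × ¬ CycNext m j i × Adj G (vtx C i) (vtx C j)

Chord : ∀ {n m} {G : Graph n} → Cycle G m → Set
Chord {m = m} C = Σ (Fin m × Fin m) (IsChord C)

HasAtLeastChords : ∀ {n m} {G : Graph n} → ℕ → Cycle G m → Set
HasAtLeastChords k C = Σ (Fin k → Chord C) λ f → Injective _≡_ _≡_ (λ x → proj₁ (f x))

IsKChordalBipartite : ∀ {n} → ℕ → Graph n → Set
IsKChordalBipartite k G =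
  IsBipartite G × (∀ m → 6 ≤ m → (C : Cycle G m) → HasAtLeastChords k C)

IsTrivial : ∀ {n} → Graph n → Set
IsTrivial G = ∀ m → 6 ≤ m → ¬ Cycle G m

-- Take a shortest cycle W of length m ≥ 6. A chord of W splits it into two shorter
-- cycles; G has no odd cycles and, by minimality, none of length in [6, m), so both
-- are 4-cycles. Hence W is a hexagon whose chords all join opposite vertices i and
-- i + 3, so W has at most three chords, contradicting k ≥ 4.
module Submission where

open import Defs hiding (sym)
open import Data.Bool using (not)
open import Data.Bool.Properties using (¬-not; not-involutive)
open import Data.Fin using (Fin; toℕ; fromℕ<)
open import Data.Fin.Properties using (toℕ-fromℕ<; toℕ-injective; toℕ<n; pigeonhole)
open import Data.Nat using (ℕ; zero; suc; _+_; _*_; _≤_; _<_; z≤n; s≤s; _≤?_; _<?_)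
open import Data.Nat.Induction using (<-wellFounded)
open import Data.Nat.Properties
open import Data.Nat.Tactic.RingSolver using (solve-∀)
open import Data.Product using (_×_; proj₁; proj₂; _,_)
open import Data.Sum using (inj₁; inj₂)
open import Function.Base using (_∘′_)
open import Induction.WellFounded using (Acc; acc)
open import Relation.Binary.Definitions using (tri<; tri≈; tri>)
open import Relation.Binary.PropositionalEquality
  using (_≡_; refl; sym; trans; cong; cong₂; subst; subst₂; module ≡-Reasoning)
open import Relation.Nullary using (¬_; yes; no; contradiction)

-- A cycle whose positions are natural numbers; values at positions ≥ m are junk.
record Cycleℕ {n : ℕ} (G : Graph n) (m : ℕ) : Set where
  field
    vertex     : ℕ → Fin n
    vertex-inj : ∀ {x y} → x < m → y < m → vertex x ≡ vertex y → x ≡ y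
    len≥3      : 3 ≤ m
    step       : ∀ {t} → suc t < m → Adj G (vertex t) (vertex (suc t))
    wrap       : ∀ {t} → suc t ≡ m → Adj G (vertex t) (vertex 0)
open Cycleℕ

module _ {n : ℕ} {G : Graph n} where

  Cycleℕ⇒Cycle : ∀ {m} → Cycleℕ G m → Cycle G m
  Cycleℕ⇒Cycle {m} W = record
    { vtx     = λ i → vertex W (toℕ i)
    ; vtx-inj = λ {i} {j} e → toℕ-injective (vertex-inj W (toℕ<n i) (toℕ<n j) e)
    ; len≥3   = len≥3 W
    ; edges   = edges′
    }
    where
    edges′ : ∀ i j → CycNext m i j → Adj G (vertex W (toℕ i)) (vertex W (toℕ j))
    edges′ i j (inj₁ i+1≡j) =
      subst (Adj G _ ∘′ vertex W) i+1≡j (step W (subst (_< m) (sym i+1≡j) (toℕ<n j)))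
    edges′ i j (inj₂ (i+1≡m , j≡0)) = subst (Adj G _ ∘′ vertex W) (sym j≡0) (wrap W i+1≡m)

  Cycle⇒Cycleℕ : ∀ {m} → Cycle G m → Cycleℕ G m
  Cycle⇒Cycleℕ {m} C = record
    { vertex     = at
    ; vertex-inj = at-inj
    ; len≥3      = len≥3 C
    ; step       = λ {t} t+1<m → edge-at (<-trans (n<1+n t) t+1<m) t+1<m
        (inj₁ (trans (cong suc (toℕ-fromℕ< _)) (sym (toℕ-fromℕ< _))))
    ; wrap       = λ {t} t+1≡m → edge-at (subst (t <_) t+1≡m (n<1+n t)) 0<m
        (inj₂ (trans (cong suc (toℕ-fromℕ< _)) t+1≡m , toℕ-fromℕ< 0<m))
    }
    where
    0<m : 0 < m
    0<m = <-≤-trans (s≤s z≤n) (len≥3 C)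

    at : ℕ → Fin _
    at t with t <? m
    ... | yes t<m = vtx C (fromℕ< t<m)
    ... | no _    = vtx C (fromℕ< 0<m)

    at-< : ∀ {t} (t<m : t < m) → at t ≡ vtx C (fromℕ< t<m)
    at-< {t} t<m with t <? m
    ... | yes _  = refl
    ... | no t≮m = contradiction t<m t≮m

    at-inj : ∀ {x y} → x < m → y < m → at x ≡ at y → x ≡ y
    at-inj {x} {y} x<m y<m e = begin
      x                 ≡⟨ sym (toℕ-fromℕ< x<m) ⟩
      toℕ (fromℕ< x<m)  ≡⟨ cong toℕ (vtx-inj C (trans (sym (at-< x<m)) (trans e (at-< y<m)))) ⟩
      toℕ (fromℕ< y<m)  ≡⟨ toℕ-fromℕ< y<m ⟩
      y                 ∎
      where open ≡-Reasoning

    edge-at : ∀ {x y} (x<m : x < m) (y<m : y < m)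
            → CycNext m (fromℕ< x<m) (fromℕ< y<m) → Adj G (at x) (at y)
    edge-at x<m y<m next = subst₂ (Adj G) (sym (at-< x<m)) (sym (at-< y<m)) (edges C _ _ next)

  bipartite⇒no-odd-cycle : IsBipartite G → ∀ h → ¬ Cycleℕ G (suc (2 * h))
  bipartite⇒no-odd-cycle (colour , proper) h W =
    proper (wrap W refl) (colour-even h ≤-refl)
    where
    colour-2-periodic : ∀ {t} → suc (suc t) < suc (2 * h)
                      → colour (vertex W (suc (suc t))) ≡ colour (vertex W t)
    colour-2-periodic {t} t+2<m = begin
      colour (vertex W (suc (suc t)))             ≡⟨ sym (not-involutive _) ⟩
      not (not (colour (vertex W (suc (suc t))))) ≡⟨ cong not (sym (¬-not (proper (step W t+2<m)))) ⟩
      not (colour (vertex W (suc t)))             ≡⟨ sym (¬-not (proper (step W t+1<m))) ⟩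
      colour (vertex W t)                         ∎
      where
      open ≡-Reasoning
      t+1<m = <-trans (n<1+n _) t+2<m

    colour-even : ∀ i → 2 * i < suc (2 * h) → colour (vertex W (2 * i)) ≡ colour (vertex W 0)
    colour-even zero    _  = refl
    colour-even (suc i) lt rewrite *-suc 2 i =
      trans (colour-2-periodic lt) (colour-even i (<-trans (n<1+n _) (<-trans (n<1+n _) lt)))

  -- The chord joins positions a and a + 2 + p, and q positions follow it. It splits W
  -- into the cycle a, …, a + 2 + p and the cycle 0, …, a, a + 2 + p, …, m − 1.
  module ChordSplit {m} (W : Cycleℕ G m) (a p q : ℕ)
                    (m≡ : a + (3 + p) + q ≡ m) (0<a+q : 0 < a + q)
                    (chord : Adj G (vertex W a) (vertex W (a + (2 + p)))) where

    adj-at : ℕ → ℕ → Set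
    adj-at x y = Adj G (vertex W x) (vertex W y)

    left-bound : ∀ {t} → t < 3 + p → a + t < m
    left-bound {t} t<3+p = subst (a + t <_) m≡ (<-≤-trans (+-monoʳ-< a t<3+p) (m≤m+n _ q))

    left : Cycleℕ G (3 + p)
    left = record
      { vertex     = λ t → vertex W (a + t)
      ; vertex-inj = λ x< y< e → +-cancelˡ-≡ a _ _ (vertex-inj W (left-bound x<) (left-bound y<) e)
      ; len≥3      = m≤m+n 3 p
      ; step       = λ {t} t+1< → subst (Adj G _ ∘′ vertex W) (sym (+-suc a t))
                                    (step W (subst (_< m) (+-suc a t) (left-bound t+1<)))
      ; wrap       = left-wrap
      }
      where
      left-wrap : ∀ {t} → suc t ≡ 3 + p → Adj G (vertex W (a + t)) (vertex W (a + 0))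
      left-wrap refl rewrite +-identityʳ a = Graph.sym G chord

    left-shorter : 3 + p < m
    left-shorter = subst (3 + p <_) (trans (rearrange a p q) m≡) (+-monoˡ-≤ (3 + p) 0<a+q)
      where
      rearrange : ∀ a p q → a + q + (3 + p) ≡ a + (3 + p) + q
      rearrange = solve-∀

    skip : ℕ → ℕ
    skip t with t ≤? a
    ... | yes _ = t
    ... | no  _ = t + (1 + p)

    skip-≤ : ∀ {t} → t ≤ a → skip t ≡ t
    skip-≤ {t} t≤a with t ≤? a
    ... | yes _  = refl
    ... | no t≰a = contradiction t≤a t≰a

    skip-> : ∀ {t} → a < t → skip t ≡ t + (1 + p)
    skip-> {t} a<t with t ≤? a
    ... | yes t≤a = contradiction t≤a (<⇒≱ a<t)
    ... | no _    = refl

    skip-injective : ∀ {x y} → skip x ≡ skip y → x ≡ y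
    skip-injective {x} {y} e with x ≤? a | y ≤? a
    ... | yes _   | yes _   = e
    ... | no _    | no _    = +-cancelʳ-≡ (1 + p) x y e
    ... | yes x≤a | no y≰a  = contradiction (≤-trans (m≤m+n y (1 + p)) (subst (_≤ a) e x≤a)) y≰a
    ... | no x≰a  | yes y≤a = contradiction (≤-trans (m≤m+n x (1 + p)) (subst (_≤ a) (sym e) y≤a)) x≰a

    right+gap≡m : 2 + (a + q) + (1 + p) ≡ m
    right+gap≡m = trans (rearrange a p q) m≡
      where
      rearrange : ∀ a p q → 2 + (a + q) + (1 + p) ≡ a + (3 + p) + q
      rearrange = solve-∀

    right-bound : ∀ {t} → t < 2 + (a + q) → skip t < m
    right-bound {t} t< with t ≤? a
    ... | yes _ = subst (t <_) right+gap≡m (<-≤-trans t< (m≤m+n _ (1 + p)))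
    ... | no _  = subst (t + (1 + p) <_) right+gap≡m (+-monoˡ-< (1 + p) t<)

    right-step : ∀ {t} → suc t < 2 + (a + q) → Adj G (vertex W (skip t)) (vertex W (skip (suc t)))
    right-step {t} t+1< with <-cmp t a
    ... | tri< t<a _ _ =
      subst₂ adj-at (sym (skip-≤ (<⇒≤ t<a))) (sym (skip-≤ t<a))
        (step W (subst (_< m) (skip-≤ t<a) (right-bound t+1<)))
    ... | tri≈ _ refl _ =
      subst₂ adj-at (sym (skip-≤ ≤-refl)) (sym (trans (skip-> (n<1+n a)) (sym (+-suc a (1 + p))))) chord
    ... | tri> _ _ a<t =
      subst₂ adj-at (sym (skip-> a<t)) (sym (skip-> a<t+1))
        (step W (subst (_< m) (skip-> a<t+1) (right-bound t+1<)))
      where a<t+1 = <-trans a<t (n<1+n t)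

    right-wrap : ∀ {t} → suc t ≡ 2 + (a + q) → Adj G (vertex W (skip t)) (vertex W (skip 0))
    right-wrap {t} refl = subst₂ adj-at (sym (skip-> (s≤s (m≤m+n a q)))) (sym (skip-≤ z≤n))
                            (wrap W right+gap≡m)

    right : Cycleℕ G (2 + (a + q))
    right = record
      { vertex     = vertex W ∘′ skip
      ; vertex-inj = λ x< y< e → skip-injective (vertex-inj W (right-bound x<) (right-bound y<) e)
      ; len≥3      = s≤s (s≤s 0<a+q)
      ; step       = right-step
      ; wrap       = right-wrap
      }

    right-shorter : 2 + (a + q) < m
    right-shorter = subst (2 + (a + q) <_) right+gap≡m (m<m+n _ (s≤s z≤n))

  ShorterCyclesAreSquares : ℕ → Set
  ShorterCyclesAreSquares m = ∀ {L} → L < m → Cycleℕ G L → L ≡ 4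

  shorter-cycles-are-squares : IsBipartite G → ∀ {m} → (∀ {L} → L < m → 6 ≤ L → ¬ Cycleℕ G L)
                             → ShorterCyclesAreSquares m
  shorter-cycles-are-squares bip no-long {0} _ W = contradiction (len≥3 W) λ ()
  shorter-cycles-are-squares bip no-long {1} _ W = contradiction (len≥3 W) λ { (s≤s ()) }
  shorter-cycles-are-squares bip no-long {2} _ W = contradiction (len≥3 W) λ { (s≤s (s≤s ())) }
  shorter-cycles-are-squares bip no-long {3} _ W = contradiction W (bipartite⇒no-odd-cycle bip 1)
  shorter-cycles-are-squares bip no-long {4} _ W = refl
  shorter-cycles-are-squares bip no-long {5} _ W = contradiction W (bipartite⇒no-odd-cycle bip 2)
  shorter-cycles-are-squares bip no-long {suc (suc (suc (suc (suc (suc L)))))} L<m W =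
    contradiction W (no-long L<m (m≤m+n 6 L))

  IsMainDiagonal : ∀ {m} → Fin m × Fin m → Set
  IsMainDiagonal (i , j) = toℕ i < 3 × toℕ j ≡ toℕ i + 3

  chord-is-main-diagonal : ∀ {m} (W : Cycleℕ G m) → ShorterCyclesAreSquares m
                         → (c : Chord (Cycleℕ⇒Cycle W)) → IsMainDiagonal (proj₁ c)
  chord-is-main-diagonal {m} W squares ((i , j) , i<j , ¬i→j , ¬j→i , i~j)
    with m≤n⇒∃[o]m+o≡n (≤∧≢⇒< i<j (¬i→j ∘′ inj₁)) | m≤n⇒∃[o]m+o≡n (toℕ<n j)
  ... | p , 2+i+p≡j | q , 1+j+q≡m =
    s≤s (subst (toℕ i ≤_) a+q≡2 (m≤m+n (toℕ i) q)) ,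
    trans (sym j≡) (cong (λ z → toℕ i + (2 + z)) p≡1)
    where
    a = toℕ i

    j≡ : a + (2 + p) ≡ toℕ j
    j≡ = trans (+-suc a (1 + p)) (trans (cong suc (+-suc a p)) 2+i+p≡j)

    m≡ : a + (3 + p) + q ≡ m
    m≡ = trans (cong (_+ q) (+-suc a (2 + p))) (trans (cong (λ z → suc z + q) j≡) 1+j+q≡m)

    0<a+q : 0 < a + q
    0<a+q = n≢0⇒n>0 λ a+q≡0 → ¬j→i (inj₂ (j+1≡m (m+n≡0⇒n≡0 a a+q≡0) , m+n≡0⇒m≡0 a a+q≡0))
      where
      j+1≡m : q ≡ 0 → suc (toℕ j) ≡ m
      j+1≡m refl = trans (sym (+-identityʳ _)) 1+j+q≡m

    open ChordSplit W a p q m≡ 0<a+q (subst (Adj G _ ∘′ vertex W) (sym j≡) i~j)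

    p≡1 : p ≡ 1
    p≡1 = +-cancelˡ-≡ 3 p 1 (squares left-shorter left)

    a+q≡2 : a + q ≡ 2
    a+q≡2 = +-cancelˡ-≡ 2 (a + q) 2 (squares right-shorter right)

  main-diagonals≤3 : ∀ {m k} {C : Cycle G m} → (∀ (c : Chord C) → IsMainDiagonal (proj₁ c))
                   → HasAtLeastChords k C → k ≤ 3
  main-diagonals≤3 {C = C} diagonal (f , f-inj) = ≮⇒≥ λ 3<k →
    let (x , y , x<y , e) = pigeonhole 3<k (code ∘′ f)
    in <-irrefl (cong toℕ (f-inj (code-injective (f x) (f y) e))) x<y
    where
    code : Chord C → Fin 3
    code c = fromℕ< (proj₁ (diagonal c))

    code-injective : ∀ c c′ → code c ≡ code c′ → proj₁ c ≡ proj₁ c′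
    code-injective c c′ e = cong₂ _,_ (toℕ-injective i≡i′) (toℕ-injective j≡j′)
      where
      i≡i′ : toℕ (proj₁ (proj₁ c)) ≡ toℕ (proj₁ (proj₁ c′))
      i≡i′ = trans (sym (toℕ-fromℕ< _)) (trans (cong toℕ e) (toℕ-fromℕ< _))

      j≡j′ : toℕ (proj₂ (proj₁ c)) ≡ toℕ (proj₂ (proj₁ c′))
      j≡j′ = trans (proj₂ (diagonal c)) (trans (cong (_+ 3) i≡i′) (sym (proj₂ (diagonal c′))))

  no-long-cycle : ∀ {k} → 4 ≤ k → IsKChordalBipartite k G → ∀ m → Acc _<_ m → 6 ≤ m → ¬ Cycleℕ G m
  no-long-cycle 4≤k (bip , chordal) m (acc rec) 6≤m W =
    <⇒≱ 4≤k (main-diagonals≤3 {C = Cycleℕ⇒Cycle W}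
               (chord-is-main-diagonal W squares) (chordal m 6≤m (Cycleℕ⇒Cycle W)))
    where
    squares : ShorterCyclesAreSquares m
    squares = shorter-cycles-are-squares bip λ L<m 6≤L →
      no-long-cycle 4≤k (bip , chordal) _ (rec L<m) 6≤L

theorem4p3 : (k : ℕ) → 4 ≤ k → (n : ℕ) → (G : Graph n) → IsKChordalBipartite k G → IsTrivial G
theorem4p3 k 4≤k n G chordal m 6≤m C =
  no-long-cycle 4≤k chordal m (<-wellFounded m) 6≤m (Cycle⇒Cycleℕ C)
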